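{- Let $r \geq 3$, set $k = \max\{1, r-3\}$, and let $G$ be a graph on $n \geq 10r$ vertices with $\delta(G) \geq \lfloor n/2 \rfloor + k$. If $A \subseteq V(G)$ satisfies $\langle A \rangle_r = A$, then either $|A| \leq 2(r-1)$ or $|A| \geq \lfloor n/2 \rfloor - \min\{1, r-3\}$.
   Context: Graphs are finite and simple; $\delta(G)$ is the minimum degree and $N(v)$ the neighbourhood of $v$. For an integer $r \geq 2$, the $r$-neighbour bootstrap process on $G$ started from $A \subseteq V(G)$ is defined by $A_0 = A$ and $A_t = A_{t-1} \cup \{v \in V(G) : |N(v) \cap A_{t-1}| \geq r\}$ for $t \geq 1$. The closure is $\langle A \rangle_r = \bigcup_{t \geq 0} A_t$; $A$ is called closed if $\langle A \rangle_r = A$. -}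

module Defs where

open import Data.Nat using (ℕ; zero; suc; _≤_; _≤ᵇ_)
open import Data.Bool using (Bool; true; false)
open import Data.Fin using (Fin)
open import Data.Fin.Subset using (Subset; _∈_; _∩_; _∪_; ∣_∣)
open import Data.Vec using (tabulate)
open import Data.Product using (∃)
open import Relation.Binary.PropositionalEquality using (_≡_)
open import Relation.Nullary using (¬_)
open import Function.Bundles using (_⇔_)

record Graph (n : ℕ) : Set where
  field
    adj   : Fin n → Fin n → Bool
    sym   : ∀ u v → adj u v ≡ adj v u
    loopless : ∀ v → adj v v ≡ false

open Graph public

N : ∀ {n} → Graph n → Fin n → Subset n
N G v = tabulate (adj G v)

degree : ∀ {n} → Graph n → Fin n → ℕ
degree G v = ∣ N G v ∣

MinDegreeAtLeast : ∀ {n} → Graph n → ℕ → Set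
MinDegreeAtLeast G d = ∀ v → d ≤ degree G v

step : ∀ {n} → Graph n → ℕ → Subset n → Subset n
step G r A = A ∪ tabulate (λ v → r ≤ᵇ ∣ N G v ∩ A ∣)

iter : ∀ {n} → Graph n → ℕ → Subset n → ℕ → Subset n
iter G r A zero = A
iter G r A (suc t) = step G r (iter G r A t)

InClosure : ∀ {n} → Graph n → ℕ → Subset n → Fin n → Set
InClosure G r A v = ∃ λ t → v ∈ iter G r A t

Closed : ∀ {n} → Graph n → ℕ → Subset n → Set
Closed G r A = ∀ v → InClosure G r A v ⇔ v ∈ A

-- Let x = |A| for a closed set A. A vertex outside A has fewer than r neighbours in A (otherwise the
-- process would add it), while a vertex of A has at most x - 1 neighbours in A, hence at least δ + 1 - x
-- outside it. Counting the edges between A and its complement from both sides gives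
--   x (δ + 1 - x) ≤ (r - 1)(n - x).
-- The window a = 2r - 1 ≤ x ≤ ⌊n/2⌋ - min{1, r-3} - 1 = b is exactly balanced, a + b = δ + r, so
-- (x - a)(b - x) ≥ 0 turns the counting bound into ab ≤ (r - 1) n, which is false as soon as n ≥ 10r.
module Submission where

open import Data.Bool using (Bool; true; false; _∧_)
open import Data.Bool.Properties using (T-≡)
open import Data.Empty using (⊥; ⊥-elim)
open import Data.Fin using (Fin; zero; suc)
open import Data.Fin.Subset using (Subset; _∈_; _∉_; _∩_; ∁; ∣_∣; inside; outside)
open import Data.Fin.Subset.Properties
  using (∣p∣≤n; ∣∁p∣≡n∸∣p∣; p⊂q⇒∣p∣<∣q∣; p∩q⊆q; x∈p∩q⁻; x∈p∪q⁺; x∈∁p⇒x∉p)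
open import Data.Nat using (ℕ; zero; suc; _+_; _*_; _∸_; _/_; _⊔_; _⊓_; _≤_; _<_; z≤n; s≤s; s≤s⁻¹)
open import Data.Nat.DivMod using (m≡m%n+[m/n]*n; m%n<n; m*n/n≡m; /-monoˡ-≤)
open import Data.Nat.Properties
open import Algebra.Properties.Semiring.Sum +-*-semiring
  using (sum; sum-syntax; ∑-distrib-+; ∑-comm; sum-cong-≗; *-distribˡ-sum; *-distribʳ-sum)
open import Data.Nat.Tactic.RingSolver using (solve-∀)
open import Data.Product using (_,_; proj₁)
open import Data.Sum using (_⊎_; inj₁; inj₂)
open import Data.Vec using ([]; _∷_; lookup; tabulate)
open import Data.Vec.Functional using (Vector)
open import Data.Vec.Properties using (lookup∘tabulate; lookup-zipWith; []=⇒lookup; lookup⇒[]=)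
open import Function using (_∘_)
open import Function.Bundles using (Equivalence)
open import Relation.Binary.PropositionalEquality
open import Relation.Nullary using (contradiction; yes; no)

open import Defs hiding (sym)

private variable n : ℕ

𝟙 : Bool → ℕ
𝟙 true  = 1
𝟙 false = 0

𝟙-∧ : ∀ x y → 𝟙 (x ∧ y) ≡ 𝟙 x * 𝟙 y
𝟙-∧ true  y = sym (+-identityʳ (𝟙 y))
𝟙-∧ false y = refl

χ : Subset n → Fin n → ℕ
χ p i = 𝟙 (lookup p i)

∣p∣≡∑χ : (p : Subset n) → ∣ p ∣ ≡ ∑[ i < n ] χ p i
∣p∣≡∑χ []            = refl
∣p∣≡∑χ (inside  ∷ p) = cong suc (∣p∣≡∑χ p)
∣p∣≡∑χ (outside ∷ p) = ∣p∣≡∑χ p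

∣p∩q∣≡∑χχ : (p q : Subset n) → ∣ p ∩ q ∣ ≡ ∑[ i < n ] (χ p i * χ q i)
∣p∩q∣≡∑χχ p q = trans (∣p∣≡∑χ (p ∩ q)) (sum-cong-≗ λ i →
  trans (cong 𝟙 (lookup-zipWith _∧_ i p q)) (𝟙-∧ (lookup p i) (lookup q i)))

∣p∣≡∣p∩q∣+∣p∩∁q∣ : (p q : Subset n) → ∣ p ∣ ≡ ∣ p ∩ q ∣ + ∣ p ∩ ∁ q ∣
∣p∣≡∣p∩q∣+∣p∩∁q∣ []            []            = refl
∣p∣≡∣p∩q∣+∣p∩∁q∣ (outside ∷ p) (_       ∷ q) = ∣p∣≡∣p∩q∣+∣p∩∁q∣ p q
∣p∣≡∣p∩q∣+∣p∩∁q∣ (inside  ∷ p) (inside  ∷ q) = cong suc (∣p∣≡∣p∩q∣+∣p∩∁q∣ p q)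
∣p∣≡∣p∩q∣+∣p∩∁q∣ (inside  ∷ p) (outside ∷ q) =
  trans (cong suc (∣p∣≡∣p∩q∣+∣p∩∁q∣ p q)) (sym (+-suc _ _))

∣p∣+∣∁p∣≡n : (p : Subset n) → ∣ p ∣ + ∣ ∁ p ∣ ≡ n
∣p∣+∣∁p∣≡n p = trans (cong (∣ p ∣ +_) (∣∁p∣≡n∸∣p∣ p)) (m+[n∸m]≡n (∣p∣≤n p))

tabulate-∈⁺ : {f : Fin n → Bool} {x : Fin n} → f x ≡ true → x ∈ tabulate f
tabulate-∈⁺ {f = f} {x} fx≡true = lookup⇒[]= x (tabulate f) (trans (lookup∘tabulate f x) fx≡true)

tabulate-∈⁻ : {f : Fin n → Bool} {x : Fin n} → x ∈ tabulate f → f x ≡ true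
tabulate-∈⁻ {f = f} {x} x∈f = trans (sym (lookup∘tabulate f x)) ([]=⇒lookup x∈f)

sum-mono-≤ : {f g : Vector ℕ n} → (∀ i → f i ≤ g i) → sum f ≤ sum g
sum-mono-≤ {zero}  f≤g = z≤n
sum-mono-≤ {suc n} f≤g = +-mono-≤ (f≤g zero) (sum-mono-≤ (λ i → f≤g (suc i)))

sumOver : Subset n → Vector ℕ n → ℕ
sumOver {n} p f = ∑[ i < n ] (χ p i * f i)

syntax sumOver p (λ i → x) = ∑[ i ∈ p ] x

∑∈-const : (p : Subset n) (c : ℕ) → ∑[ i ∈ p ] c ≡ ∣ p ∣ * c
∑∈-const p c = trans (sym (*-distribʳ-sum c (χ p))) (cong (_* c) (sym (∣p∣≡∑χ p)))

∑∈-distrib-+ : (p : Subset n) (f g : Vector ℕ n) →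
  ∑[ i ∈ p ] (f i + g i) ≡ ∑[ i ∈ p ] f i + ∑[ i ∈ p ] g i
∑∈-distrib-+ p f g = trans (sum-cong-≗ λ i → *-distribˡ-+ (χ p i) (f i) (g i))
  (∑-distrib-+ (λ i → χ p i * f i) (λ i → χ p i * g i))

∑∈-mono-≤ : (p : Subset n) {f g : Vector ℕ n} → (∀ {i} → i ∈ p → f i ≤ g i) →
  ∑[ i ∈ p ] f i ≤ ∑[ i ∈ p ] g i
∑∈-mono-≤ p {f} {g} f≤g = sum-mono-≤ termwise
  where
  termwise : ∀ i → χ p i * f i ≤ χ p i * g i
  termwise i with lookup p i in eq
  ... | true  = *-monoʳ-≤ 1 (f≤g (lookup⇒[]= i p eq))
  ... | false = z≤n

m≤n≤o⇒m*o+n*n≤n*[m+o] : ∀ {m n o} → m ≤ n → n ≤ o → m * o + n * n ≤ n * (m + o)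
m≤n≤o⇒m*o+n*n≤n*[m+o] {m} m≤n n≤o with m≤n⇒∃[o]m+o≡n m≤n | m≤n⇒∃[o]m+o≡n n≤o
... | p , refl | q , refl = ≤-trans (m≤m+n _ (p * q)) (≤-reflexive (expand m p q))
  where
  expand : ∀ m p q → m * (m + p + q) + (m + p) * (m + p) + p * q ≡ (m + p) * (m + (m + p + q))
  expand = solve-∀

s*[e+[1+c+b]*2]<[1+2s]*b : ∀ s c e b → c ≤ 1 → e ≤ 1 → 5 * suc s ≤ suc c + b →
  s * (e + (suc c + b) * 2) < suc (2 * s) * b
s*[e+[1+c+b]*2]<[1+2s]*b s c e b c≤1 e≤1 5r≤m = begin-strict
  s * (e + (suc c + b) * 2)             ≡⟨ expand s c e b ⟩
  s * e + s * c * 2 + 2 * s + 2 * s * b ≤⟨ +-monoˡ-≤ (2 * s * b) (+-monoˡ-≤ (2 * s)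
                                             (+-mono-≤ (*-monoʳ-≤ s e≤1) (*-monoˡ-≤ 2 (*-monoʳ-≤ s c≤1)))) ⟩
  s * 1 + s * 1 * 2 + 2 * s + 2 * s * b ≡⟨ collect s b ⟩
  5 * s + 2 * s * b                     <⟨ +-monoˡ-< (2 * s * b) 5s<b ⟩
  suc (2 * s) * b                       ∎
  where
  open ≤-Reasoning
  expand : ∀ s c e b → s * (e + (suc c + b) * 2) ≡ s * e + s * c * 2 + 2 * s + 2 * s * b
  expand = solve-∀
  collect : ∀ s b → s * 1 + s * 1 * 2 + 2 * s + 2 * s * b ≡ 5 * s + 2 * s * b
  collect = solve-∀
  5s<b : 5 * s < b
  5s<b = ≤-trans (m≤n+m (suc (5 * s)) 2) (+-cancelˡ-≤ 2 (3 + 5 * s) b (begin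
    5 + 5 * s  ≡⟨ *-suc 5 s ⟨
    5 * suc s  ≤⟨ 5r≤m ⟩
    suc c + b  ≤⟨ +-monoˡ-≤ b (s≤s c≤1) ⟩
    2 + b      ∎))

1⊓n+1⊔n≡1+n : ∀ n → 1 ⊓ n + (1 ⊔ n) ≡ suc n
1⊓n+1⊔n≡1+n zero    = refl
1⊓n+1⊔n≡1+n (suc n) = refl

m*2≤n⇒m≤n/2 : ∀ {m n} → m * 2 ≤ n → m ≤ n / 2
m*2≤n⇒m≤n/2 {m} m*2≤n = subst (_≤ _) (m*n/n≡m m 2) (/-monoˡ-≤ 2 m*2≤n)

m<n∸o⇒m+o<n : ∀ {m n o} → m < n ∸ o → m + o < n
m<n∸o⇒m+o<n {m} {n} {o} m<n∸o = m≤o∸n⇒m+n≤o (suc m) o≤n m<n∸o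
  where
  o≤n : o ≤ n
  o≤n = <⇒≤ (m∸n≢0⇒n<m λ n∸o≡0 → n≮0 (subst (m <_) n∸o≡0 m<n∸o))

module _ (G : Graph n) where

  v∉N[v] : ∀ v → v ∉ N G v
  v∉N[v] v v∈N = contradiction (trans (sym (tabulate-∈⁻ v∈N)) (loopless G v)) λ ()

  ∣N∩p∣<∣p∣ : ∀ {v} (p : Subset n) → v ∈ p → ∣ N G v ∩ p ∣ < ∣ p ∣
  ∣N∩p∣<∣p∣ {v} p v∈p = p⊂q⇒∣p∣<∣q∣
    (p∩q⊆q (N G v) p , v , v∈p , v∉N[v] v ∘ proj₁ ∘ x∈p∩q⁻ (N G v) p)

  χ-N-sym : ∀ u v → χ (N G u) v ≡ χ (N G v) u
  χ-N-sym u v = cong 𝟙 (begin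
    lookup (N G u) v ≡⟨ lookup∘tabulate (adj G u) v ⟩
    adj G u v        ≡⟨ Graph.sym G u v ⟩
    adj G v u        ≡⟨ lookup∘tabulate (adj G v) u ⟨
    lookup (N G v) u ∎)
    where open ≡-Reasoning

  edges : Subset n → Subset n → ℕ
  edges p q = ∑[ u ∈ p ] ∣ N G u ∩ q ∣

  edges≡∑∑ : (p q : Subset n) → edges p q ≡ ∑[ u < n ] ∑[ v < n ] (χ p u * (χ (N G u) v * χ q v))
  edges≡∑∑ p q = sum-cong-≗ λ u →
    trans (cong (χ p u *_) (∣p∩q∣≡∑χχ (N G u) q)) (*-distribˡ-sum (χ p u) (λ v → χ (N G u) v * χ q v))

  edges-sym : (p q : Subset n) → edges p q ≡ edges q p
  edges-sym p q = begin
    edges p q                                              ≡⟨ edges≡∑∑ p q ⟩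
    ∑[ u < n ] ∑[ v < n ] (χ p u * (χ (N G u) v * χ q v))   ≡⟨ ∑-comm (λ u v → χ p u * (χ (N G u) v * χ q v)) ⟩
    ∑[ v < n ] ∑[ u < n ] (χ p u * (χ (N G u) v * χ q v))   ≡⟨ sum-cong-≗ (λ v → sum-cong-≗ λ u → swap u v) ⟩
    ∑[ v < n ] ∑[ u < n ] (χ q v * (χ (N G v) u * χ p u))   ≡⟨ edges≡∑∑ q p ⟨
    edges q p                                              ∎
    where
    open ≡-Reasoning
    x*[y*z]≡z*[y*x] : ∀ x y z → x * (y * z) ≡ z * (y * x)
    x*[y*z]≡z*[y*x] = solve-∀
    swap : ∀ u v → χ p u * (χ (N G u) v * χ q v) ≡ χ q v * (χ (N G v) u * χ p u)
    swap u v rewrite χ-N-sym u v = x*[y*z]≡z*[y*x] (χ p u) (χ (N G v) u) (χ q v)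

  closed⇒∣N∩A∣<r : ∀ {r A} → Closed G r A → ∀ {v} → v ∉ A → ∣ N G v ∩ A ∣ < r
  closed⇒∣N∩A∣<r {r} {A} closed {v} v∉A with r ≤? ∣ N G v ∩ A ∣
  ... | no  r≰ = ≰⇒> r≰
  ... | yes r≤ = contradiction (Equivalence.to (closed v) (1 , v∈A₁)) v∉A
    where
    v∈A₁ : v ∈ iter G r A 1
    v∈A₁ = x∈p∪q⁺ (inj₂ (tabulate-∈⁺ (Equivalence.to T-≡ (≤⇒≤ᵇ r≤))))

  closed⇒edge-bound : ∀ {r D A} → MinDegreeAtLeast G D → Closed G (suc r) A →
    ∣ A ∣ * suc D ≤ ∣ ∁ A ∣ * r + ∣ A ∣ * ∣ A ∣
  closed⇒edge-bound {r} {D} {A} δ≥D closed = begin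
    ∣ A ∣ * suc D                            ≡⟨ ∑∈-const A (suc D) ⟨
    ∑[ u ∈ A ] suc D                         ≤⟨ ∑∈-mono-≤ A inside-bound ⟩
    ∑[ u ∈ A ] (∣ N G u ∩ ∁ A ∣ + ∣ A ∣)      ≡⟨ ∑∈-distrib-+ A (λ u → ∣ N G u ∩ ∁ A ∣) (λ _ → ∣ A ∣) ⟩
    edges A (∁ A) + ∑[ u ∈ A ] ∣ A ∣          ≡⟨ cong₂ _+_ (edges-sym A (∁ A)) (∑∈-const A ∣ A ∣) ⟩
    edges (∁ A) A + ∣ A ∣ * ∣ A ∣             ≤⟨ +-monoˡ-≤ _ (∑∈-mono-≤ (∁ A) outside-bound) ⟩
    ∑[ v ∈ ∁ A ] r + ∣ A ∣ * ∣ A ∣            ≡⟨ cong (_+ ∣ A ∣ * ∣ A ∣) (∑∈-const (∁ A) r) ⟩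
    ∣ ∁ A ∣ * r + ∣ A ∣ * ∣ A ∣               ∎
    where
    open ≤-Reasoning
    inside-bound : ∀ {u} → u ∈ A → suc D ≤ ∣ N G u ∩ ∁ A ∣ + ∣ A ∣
    inside-bound {u} u∈A = begin
      suc D                                ≤⟨ s≤s (δ≥D u) ⟩
      suc (degree G u)                     ≡⟨ cong suc (∣p∣≡∣p∩q∣+∣p∩∁q∣ (N G u) A) ⟩
      suc ∣ N G u ∩ A ∣ + ∣ N G u ∩ ∁ A ∣   ≤⟨ +-monoˡ-≤ _ (∣N∩p∣<∣p∣ A u∈A) ⟩
      ∣ A ∣ + ∣ N G u ∩ ∁ A ∣               ≡⟨ +-comm ∣ A ∣ _ ⟩
      ∣ N G u ∩ ∁ A ∣ + ∣ A ∣               ∎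
    outside-bound : ∀ {v} → v ∈ ∁ A → ∣ N G v ∩ A ∣ ≤ r
    outside-bound v∈∁A = s≤s⁻¹ (closed⇒∣N∩A∣<r closed (x∈∁p⇒x∉p v∈∁A))

  closed-size-gap : ∀ {r D A a b} → MinDegreeAtLeast G D → Closed G (suc r) A →
    a ≤ ∣ A ∣ → ∣ A ∣ ≤ b → a + b ≤ D + suc r → a * b ≤ r * n
  closed-size-gap {r} {D} {A} {a} {b} δ≥D closed a≤x x≤b a+b≤ = +-cancelʳ-≤ (x * x) (a * b) (r * n) (begin
    a * b + x * x            ≤⟨ m≤n≤o⇒m*o+n*n≤n*[m+o] a≤x x≤b ⟩
    x * (a + b)              ≤⟨ *-monoʳ-≤ x a+b≤ ⟩
    x * (D + suc r)          ≡⟨ distrib x D r ⟩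
    x * suc D + x * r        ≤⟨ +-monoˡ-≤ (x * r) (closed⇒edge-bound δ≥D closed) ⟩
    y * r + x * x + x * r    ≡⟨ collect x y r ⟩
    r * (x + y) + x * x      ≡⟨ cong (λ m → r * m + x * x) (∣p∣+∣∁p∣≡n A) ⟩
    r * n + x * x            ∎)
    where
    open ≤-Reasoning
    x = ∣ A ∣
    y = ∣ ∁ A ∣
    distrib : ∀ x D r → x * (D + suc r) ≡ x * suc D + x * r
    distrib = solve-∀
    collect : ∀ x y r → y * r + x * x + x * r ≡ r * (x + y) + x * x
    collect = solve-∀

  -- In the paper's notation s = r - 1, m = ⌊n/2⌋, e = n mod 2, c = min{1, r-3}, k = max{1, r-3}.
  no-closed-set-in-window : ∀ {s c k e m A} →
    n ≡ e + m * 2 → e ≤ 1 → c ≤ 1 → suc (c + k) ≡ s → 5 * suc s ≤ m →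
    MinDegreeAtLeast G (m + k) → Closed G (suc s) A →
    2 * s < ∣ A ∣ → ∣ A ∣ + c < m → ⊥
  no-closed-set-in-window {s} {c} {k} {e} {m} {A} n≡e+m*2 e≤1 c≤1 refl 5r≤m δ≥ closed 2s<x x+c<m
    with m≤n⇒∃[o]m+o≡n (≤-trans (s≤s c≤1) (≤-trans (s≤s (s≤s z≤n)) 5r≤m))
  ... | b , refl = <⇒≱ (s*[e+[1+c+b]*2]<[1+2s]*b s c e b c≤1 e≤1 5r≤m)
    (subst (λ n → suc (2 * s) * b ≤ s * n) n≡e+m*2 (closed-size-gap δ≥ closed 2s<x x≤b a+b≤))
    where
    x≤b : ∣ A ∣ ≤ b
    x≤b = +-cancelʳ-≤ c ∣ A ∣ b (≤-trans (s≤s⁻¹ x+c<m) (≤-reflexive (+-comm c b)))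
    balance : ∀ c k b → suc (2 * suc (c + k)) + b ≡ suc c + b + k + suc (suc (c + k))
    balance = solve-∀
    a+b≤ : suc (2 * s) + b ≤ suc c + b + k + suc s
    a+b≤ = ≤-reflexive (balance c k b)

proposition3p2 : (r n : ℕ) → 3 ≤ r → 10 * r ≤ n → (G : Graph n)
    → MinDegreeAtLeast G (n / 2 + (1 ⊔ (r ∸ 3)))
    → (A : Subset n) → Closed G r A
    → ∣ A ∣ ≤ 2 * (r ∸ 1) ⊎ n / 2 ∸ (1 ⊓ (r ∸ 3)) ≤ ∣ A ∣
proposition3p2 r@(suc (suc (suc t))) n (s≤s (s≤s (s≤s z≤n))) 10r≤n G δ A closed
  with ∣ A ∣ ≤? 2 * (2 + t) | n / 2 ∸ (1 ⊓ t) ≤? ∣ A ∣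
... | yes small | _         = inj₁ small
... | no _      | yes large = inj₂ large
... | no ¬small | no ¬large = ⊥-elim (no-closed-set-in-window G
  (m≡m%n+[m/n]*n n 2) (s≤s⁻¹ (m%n<n n 2)) (m⊓n≤m 1 t) (cong suc (1⊓n+1⊔n≡1+n t))
  (m*2≤n⇒m≤n/2 (≤-trans (≤-reflexive 5r*2≡10r) 10r≤n)) δ closed
  (≰⇒> ¬small) (m<n∸o⇒m+o<n (≰⇒> ¬large)))
  where
  5r*2≡10r : 5 * r * 2 ≡ 10 * r
  5r*2≡10r = trans (*-comm (5 * r) 2) (sym (*-assoc 2 5 r))
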